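{- Let $\Sigma,\Gamma$ be as in the context and $t\geq1$. For every monotone formula $\alpha$ and all streams $\mathbf I\subseteq\mathbf J$, if $\mathbf I,t\models_\Gamma\alpha$ then $\mathbf J,t\models_\Gamma\alpha$.
   Context: $\Sigma$ is a finite nonempty set of propositional atoms containing a special symbol $\top$. Formulas: $\alpha::=a\mid\neg\alpha\mid\alpha\land\alpha\mid\alpha\lor\alpha\mid\alpha\rightarrow\alpha\mid\Diamond\alpha\mid\Box\alpha\mid @_{t'}\alpha\mid\boxplus_{[\ell,r]}\alpha$ with $a\in\Sigma$, integer $t'\geq1$, $\ell,r\in\mathbb N\cup\{\infty\}$, $\ell\leq r$. A formula is monotone if it contains none of $\neg,\rightarrow,\Box$. A stream is $\mathbf I=I_1I_2\ldots$ with $I_s\subseteq\Sigma$ for $s\geq1$; $\mathbf I\subseteq\mathbf J$ means $I_s\subseteq J_s$ for all $s$. $\mathrm{supp}\,\mathbf I$: tightest interval of time points containing $\{s\mid I_s\neq\emptyset\}$, with $\mathrm{supp}$ of the all-empty stream being $\emptyset$. $\mathbf I[\ell,r;s]$ agrees with $\mathbf I$ at $u$ with $s-\ell\leq u\leq s+r$, empty elsewhere. Fix $\Gamma\subseteq\Sigma$. Entailment: $\mathbf I,s\models_\Gamma\top$; for $a\neq\top$, $\mathbf I,s\models_\Gamma a$ iff $a\in I_s\cup\Gamma$; $\neg,\land,\lor,\rightarrow$ classically; $\mathbf I,s\models_\Gamma\Diamond\alpha$ iff $\mathbf I,s'\models_\Gamma\alpha$ for some $s'\in\mathrm{supp}\,\mathbf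 I$; $\mathbf I,s\models_\Gamma\Box\alpha$ iff for all $s'\in\mathrm{supp}\,\mathbf I$; $\mathbf I,s\models_\Gamma@_{s'}\alpha$ iff $\mathbf I,s'\models_\Gamma\alpha$; $\mathbf I,s\models_\Gamma\boxplus_{[\ell,r]}\alpha$ iff $\mathbf I[\ell,r;s],s\models_\Gamma\alpha$. -}

module Defs where

open import Data.Nat using (ℕ; _≤_; _+_)
open import Data.Fin using (Fin)
open import Data.Product using (Σ; ∃; _×_)
open import Data.Sum using (_⊎_)
open import Data.Unit using (⊤)
open import Data.Empty using (⊥)
open import Relation.Nullary using (¬_)
open import Relation.Binary.PropositionalEquality using (_≡_)

data ℕ∞ : Set where
  fin : ℕ → ℕ∞
  ∞   : ℕ∞

data _≤∞_ : ℕ∞ → ℕ∞ → Set where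
  fin≤fin : ∀ {m n} → m ≤ n → fin m ≤∞ fin n
  _≤∞∞    : ∀ x → x ≤∞ ∞

-- The atoms Σ are Fin n (finite); `top` is the special symbol ⊤ (so Σ is nonempty).
module Logic (n : ℕ) (top : Fin n) where

  Atom : Set
  Atom = Fin n

  data Form : Set where
    atom  : Atom → Form
    ¬'_   : Form → Form
    _∧'_  : Form → Form → Form
    _∨'_  : Form → Form → Form
    _⇒'_  : Form → Form → Form
    ◇_    : Form → Form
    □_    : Form → Form
    at    : (t' : ℕ) → 1 ≤ t' → Form → Form
    ⊞     : (ℓ r : ℕ∞) → ℓ ≤∞ r → Form → Form

  data Monotone : Form → Set where
    m-atom : ∀ a → Monotone (atom a)
    m-∧    : ∀ {α β} → Monotone α → Monotone β → Monotone (α ∧' β)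
    m-∨    : ∀ {α β} → Monotone α → Monotone β → Monotone (α ∨' β)
    m-◇    : ∀ {α} → Monotone α → Monotone (◇ α)
    m-at   : ∀ {t' p α} → Monotone α → Monotone (at t' p α)
    m-⊞    : ∀ {ℓ r p α} → Monotone α → Monotone (⊞ ℓ r p α)

  -- A stream: I s a means a ∈ I_s. Only time points s ≥ 1 are meaningful.
  Stream : Set₁
  Stream = ℕ → Atom → Set

  _⊆ₛ_ : Stream → Stream → Set
  I ⊆ₛ J = ∀ s → 1 ≤ s → ∀ a → I s a → J s a

  NonEmptyAt : Stream → ℕ → Set
  NonEmptyAt I u = 1 ≤ u × ∃ λ a → I u a

  -- s ∈ supp I : s lies in the tightest interval containing all nonempty time points
  InSupp : Stream → ℕ → Set
  InSupp I s = 1 ≤ s × (∃ λ u → u ≤ s × NonEmptyAt I u) × (∃ λ v → s ≤ v × NonEmptyAt I v)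

  lowOK : ℕ∞ → ℕ → ℕ → Set
  lowOK (fin ℓ) s u = s ≤ u + ℓ     -- s - ℓ ≤ u
  lowOK ∞       s u = ⊤

  highOK : ℕ∞ → ℕ → ℕ → Set
  highOK (fin r) s u = u ≤ s + r
  highOK ∞       s u = ⊤

  window : Stream → ℕ∞ → ℕ∞ → ℕ → Stream
  window I ℓ r s u a = lowOK ℓ s u × highOK r s u × I u a

  sat : (Γ : Atom → Set) → Stream → ℕ → Form → Set
  sat Γ I s (atom a)      = a ≡ top ⊎ (I s a ⊎ Γ a)
  sat Γ I s (¬' α)        = ¬ sat Γ I s α
  sat Γ I s (α ∧' β)      = sat Γ I s α × sat Γ I s β
  sat Γ I s (α ∨' β)      = sat Γ I s α ⊎ sat Γ I s β
  sat Γ I s (α ⇒' β)      = sat Γ I s α → sat Γ I s β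
  sat Γ I s (◇ α)         = ∃ λ s' → InSupp I s' × sat Γ I s' α
  sat Γ I s (□ α)         = ∀ s' → InSupp I s' → sat Γ I s' α
  sat Γ I s (at t' _ α)   = sat Γ I t' α
  sat Γ I s (⊞ ℓ r _ α)   = sat Γ (window I ℓ r s) s α

-- Induction on the formula.  ◇ survives enlarging the stream because that can
-- only widen the hull of its nonempty points, so supp I ⊆ supp J; ⊞ survives
-- because cutting both streams to the same window preserves inclusion.  Time
-- points only move (under ◇ and @) to points ≥ 1, the only ones inclusion of
-- streams speaks about.
module Submission where

open import Defs
open import Data.Nat using (ℕ; _≤_)
open import Data.Fin using (Fin)
open import Data.Product using (_,_)
open import Data.Sum using (map)
open import Function using (id)

module _ (n : ℕ) (top : Fin n) (Γ : Fin n → Set) where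
  open Logic n top

  InSupp-mono : ∀ {I J} → I ⊆ₛ J → ∀ s → InSupp I s → InSupp J s
  InSupp-mono I⊆J s (1≤s , (u , u≤s , 1≤u , a , Iua) , (v , s≤v , 1≤v , b , Ivb)) =
    1≤s , (u , u≤s , 1≤u , a , I⊆J u 1≤u a Iua) , (v , s≤v , 1≤v , b , I⊆J v 1≤v b Ivb)

  window-mono : ∀ {I J} ℓ r s → I ⊆ₛ J → window I ℓ r s ⊆ₛ window J ℓ r s
  window-mono ℓ r s I⊆J u 1≤u a (low , high , Iua) = low , high , I⊆J u 1≤u a Iua

  sat-mono : ∀ {α} → Monotone α → ∀ {I J} → I ⊆ₛ J → ∀ t → 1 ≤ t → sat Γ I t α → sat Γ J t α
  sat-mono (m-atom a)  I⊆J t 1≤t = map id (map (I⊆J t 1≤t a) id)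
  sat-mono (m-∧ mα mβ) I⊆J t 1≤t (Iα , Iβ) = sat-mono mα I⊆J t 1≤t Iα , sat-mono mβ I⊆J t 1≤t Iβ
  sat-mono (m-∨ mα mβ) I⊆J t 1≤t = map (sat-mono mα I⊆J t 1≤t) (sat-mono mβ I⊆J t 1≤t)
  sat-mono (m-◇ mα) I⊆J t 1≤t (s , s∈supp@(1≤s , _) , Iα) =
    s , InSupp-mono I⊆J s s∈supp , sat-mono mα I⊆J s 1≤s Iα
  sat-mono (m-at {t' = t'} {p = 1≤t'} mα) I⊆J t 1≤t = sat-mono mα I⊆J t' 1≤t'
  sat-mono (m-⊞ {ℓ = ℓ} {r = r} mα) I⊆J t 1≤t = sat-mono mα (window-mono ℓ r t I⊆J) t 1≤t

proposition7 : (n : ℕ) (top : Fin n) (Γ : Fin n → Set) (t : ℕ) → 1 ≤ t → (α : Logic.Form n top) → Logic.Monotone n top α → (I J : Logic.Stream n top) → Logic._⊆ₛ_ n top I J → Logic.sat n top Γ I t α → Logic.sat n top Γ J t α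
proposition7 n top Γ t 1≤t α mono I J I⊆J = sat-mono n top Γ mono I⊆J t 1≤t
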